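{- For every integer $\ell\ge 2$ and every integer $n\ge 2\ell$ there exists a digraph $D$ on $n$ vertices with $\delta(D)=\lceil n/2\rceil+\ell-2$ which is not $\ell$-linked.
   Context: Digraphs are finite, without loops, with at most one edge in each direction between any two vertices. The minimum degree of a digraph $D$ is $\delta(D):=\min\{\delta^+(D),\delta^-(D)\}$, where $\delta^+(D)$ and $\delta^-(D)$ are the minimum outdegree and minimum indegree of $D$. A digraph $D$ is $\ell$-linked if $|D|\ge 2\ell$ and for every sequence $x_1,\dots,x_\ell,y_1,\dots,y_\ell$ of distinct vertices of $D$ there are vertex-disjoint directed paths $P_1,\dots,P_\ell$ in $D$ such that $P_i$ goes from $x_i$ to $y_i$ for each $i$. -}

module Defs where

open import Data.Nat using (ℕ; zero; suc; _+_; _≤_)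
open import Data.Bool using (Bool; true; false; if_then_else_)
open import Data.Fin using (Fin)
open import Data.List using (List; []; _∷_; allFin; filter; length)
open import Data.List.Membership.Propositional using (_∈_)
open import Data.List.Relation.Unary.Unique.Propositional using (Unique)
open import Data.List.Relation.Unary.All using (All)
open import Data.Product using (Σ; _×_; ∃; ∃-syntax; _,_)
open import Data.Sum using (_⊎_)
open import Function.Definitions using (Injective)
open import Relation.Binary.PropositionalEquality using (_≡_; _≢_)
open import Relation.Nullary using (¬_)
open import Data.Bool using (T)
open import Relation.Nullary.Decidable using (Dec)
open import Data.Bool.Properties using (T?)

record Digraph (n : ℕ) : Set where
  field
    adj   : Fin n → Fin n → Bool
    loopless : ∀ v → adj v v ≡ false
open Digraph public

Edge : ∀ {n} → Digraph n → Fin n → Fin n → Set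
Edge D u v = T (adj D u v)

outdeg : ∀ {n} → Digraph n → Fin n → ℕ
outdeg {n} D v = length (filter (λ w → T? (adj D v w)) (allFin n))

indeg : ∀ {n} → Digraph n → Fin n → ℕ
indeg {n} D v = length (filter (λ w → T? (adj D w v)) (allFin n))

-- δ(D) = min{δ⁺(D), δ⁻(D)} = k : every out- and in-degree is ≥ k,
-- and some out- or in-degree equals k.
MinDegreeIs : ∀ {n} → Digraph n → ℕ → Set
MinDegreeIs {n} D k =
  (∀ v → k ≤ outdeg D v × k ≤ indeg D v) ×
  (∃[ v ] (outdeg D v ≡ k ⊎ indeg D v ≡ k))

Walk : ∀ {n} → Digraph n → List (Fin n) → Set
Walk D [] = Data.Unit.⊤ where import Data.Unit
Walk D (u ∷ []) = Data.Unit.⊤ where import Data.Unit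
Walk D (u ∷ v ∷ vs) = Edge D u v × Walk D (v ∷ vs)

StartsAt : ∀ {n} → List (Fin n) → Fin n → Set
StartsAt [] x = Data.Empty.⊥ where import Data.Empty
StartsAt (u ∷ _) x = u ≡ x

EndsAt : ∀ {n} → List (Fin n) → Fin n → Set
EndsAt [] y = Data.Empty.⊥ where import Data.Empty
EndsAt (u ∷ []) y = u ≡ y
EndsAt (u ∷ v ∷ vs) y = EndsAt (v ∷ vs) y

IsPath : ∀ {n} → Digraph n → Fin n → Fin n → List (Fin n) → Set
IsPath D x y P = StartsAt P x × EndsAt P y × Walk D P × Unique P

Disjoint : ∀ {n} → List (Fin n) → List (Fin n) → Set
Disjoint P Q = ∀ v → v ∈ P → ¬ (v ∈ Q)

AllDistinct : ∀ {n ℓ} → (Fin ℓ → Fin n) → (Fin ℓ → Fin n) → Set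
AllDistinct x y = Injective _≡_ _≡_ x × Injective _≡_ _≡_ y × (∀ i j → x i ≢ y j)

Linked : ∀ {n} → ℕ → Digraph n → Set
Linked {n} ℓ D =
  (ℓ + ℓ ≤ n) ×
  ((x y : Fin ℓ → Fin n) → AllDistinct x y →
    Σ (Fin ℓ → List (Fin n)) λ P →
      (∀ i → IsPath D (x i) (y i) (P i)) ×
      (∀ i j → i ≢ j → Disjoint (P i) (P j)))

-- Write n = 2ℓ + r and q = ⌊r/2⌋. Take the complete digraph on n vertices and delete
-- all arcs from A₁ to B₁ and from A₂ to B₂, where each of these four sets has size
-- q + 1, A₁ ∩ A₂ = B₁ ∩ B₂ = ∅, x₁ ∈ A₁, y₁ ∈ B₁, x₂ ∈ A₂, y₂ ∈ B₂, and the r vertices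
-- that are not terminals lie in A₁ ∪ B₁ and in A₂ ∪ B₂, except for at most one hub h.
-- Every vertex then loses at most q + 1 out- and in-arcs, so δ = n − q − 2. A path
-- from x₁ to y₁ has to leave A₁, and an arc leaving A₁ avoids B₁, so it ends at a
-- terminal of another pair or at h; in a linkage it must therefore use h. The same
-- holds for the path from x₂ to y₂ and A₂, so the two paths meet.

module Submission where

open import Defs
open import Data.Bool using (Bool; true; false; T; not; _∧_; _∨_; if_then_else_)
open import Data.Bool.Properties using (T?; T-∧; T-∨; T-≡)
open import Data.Empty using (⊥; ⊥-elim)
open import Data.Fin using (Fin; zero; suc; toℕ; _↑ˡ_; _↑ʳ_; splitAt)
open import Data.Fin.Properties
  using (toℕ-injective; toℕ<n; toℕ-↑ˡ; toℕ-↑ʳ; ↑ˡ-injective; ↑ʳ-injective; splitAt⁻¹-↑ˡ; splitAt⁻¹-↑ʳ)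
  renaming (_≟_ to _≟ᶠ_)
open import Data.List using (List; []; _∷_; filter; length; tabulate; allFin)
open import Data.List.Membership.Propositional using (_∈_)
open import Data.List.Relation.Unary.Any using (here; there)
open import Data.Nat
open import Data.Nat.Properties
open import Data.Nat.Solver using (module +-*-Solver)
open import Data.Product using (Σ; _×_; _,_; ∃-syntax; proj₁; proj₂)
import Data.Product as Product
open import Data.Sum using (_⊎_; inj₁; inj₂; [_,_]′)
import Data.Sum as Sum
open import Function using (_∘_; id; Equivalence)
open import Relation.Binary.PropositionalEquality
open import Relation.Nullary using (¬_; yes; no)

-- Counting

count : (ℕ → Bool) → ℕ → ℕ
count g zero    = 0
count g (suc n) = if g n then suc (count g n) else count g n

count-step : ∀ {g j} → T (g j) → count g (suc j) ≡ suc (count g j)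
count-step {g} {j} gj with g j | gj
... | true | _ = refl

count-⊆ : ∀ {g h} → (∀ j → T (g j) → T (h j)) → ∀ n → count g n ≤ count h n
count-⊆ g⊆h zero = z≤n
count-⊆ {g} {h} g⊆h (suc n) with g n | h n | g⊆h n
... | true  | true  | _     = s≤s (count-⊆ g⊆h n)
... | true  | false | gn⇒hn = ⊥-elim (gn⇒hn _)
... | false | true  | _     = m≤n⇒m≤1+n (count-⊆ g⊆h n)
... | false | false | _     = count-⊆ g⊆h n

count-monoʳ : ∀ g {m n} → m ≤ n → count g m ≤ count g n
count-monoʳ g = mono ∘ ≤⇒≤′
  where
  mono : ∀ {m n} → m ≤′ n → count g m ≤ count g n
  mono ≤′-refl = ≤-refl
  mono (≤′-step {n} m≤′n) with g n
  ... | true  = m≤n⇒m≤1+n (mono m≤′n)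
  ... | false = mono m≤′n

count-∨ : ∀ g h n → count (λ j → g j ∨ h j) n ≤ count g n + count h n
count-∨ g h zero = z≤n
count-∨ g h (suc n) with g n | h n | count-∨ g h n
... | true  | true  | ih = s≤s (≤-trans ih (+-monoʳ-≤ (count g n) (n≤1+n _)))
... | true  | false | ih = s≤s ih
... | false | true  | ih = ≤-trans (s≤s ih) (≤-reflexive (sym (+-suc _ _)))
... | false | false | ih = ih

count-complement : ∀ g n → count g n + count (not ∘ g) n ≡ n
count-complement g zero = refl
count-complement g (suc n) with g n | count-complement g n
... | true  | ih = cong suc ih
... | false | ih = trans (+-suc _ _) (cong suc ih)

count-not : ∀ g n → count (not ∘ g) n ≡ n ∸ count g n
count-not g n = begin
  count (not ∘ g) n                          ≡⟨ m+n∸m≡n (count g n) _ ⟨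
  count g n + count (not ∘ g) n ∸ count g n  ≡⟨ cong (_∸ count g n) (count-complement g n) ⟩
  n ∸ count g n                              ∎
  where open ≡-Reasoning

count-⊆-interval : ∀ {g} a w → (∀ j → T (g j) → a ≤ j × j < a + w) → ∀ n → count g n ≤ w
count-⊆-interval {g} a w g⊆ n = begin
  count g n        ≤⟨ bounded n ⟩
  n ⊓ (a + w) ∸ a  ≤⟨ ∸-monoˡ-≤ a (m⊓n≤n n (a + w)) ⟩
  a + w ∸ a        ≡⟨ m+n∸m≡n a w ⟩
  w                ∎
  where
  open ≤-Reasoning
  bounded : ∀ n → count g n ≤ n ⊓ (a + w) ∸ a
  bounded zero = z≤n
  bounded (suc n) with g n | g⊆ n
  ... | false | _ = ≤-trans (bounded n) (∸-monoˡ-≤ a (⊓-monoˡ-≤ (a + w) (n≤1+n n)))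
  ... | true  | n∈ with n∈ _
  ...   | a≤n , n<a+w = begin
    suc (count g n)        ≤⟨ s≤s (bounded n) ⟩
    suc (n ⊓ (a + w) ∸ a)  ≡⟨ cong (λ k → suc (k ∸ a)) (m≤n⇒m⊓n≡m (<⇒≤ n<a+w)) ⟩
    suc (n ∸ a)            ≡⟨ +-∸-assoc 1 a≤n ⟨
    suc n ∸ a              ≡⟨ cong (_∸ a) (m≤n⇒m⊓n≡m n<a+w) ⟨
    suc n ⊓ (a + w) ∸ a    ∎

count-singleton : ∀ {g} v → (∀ j → T (g j) → j ≡ v) → ∀ n → count g n ≤ 1
count-singleton {g} v g⊆ = count-⊆-interval {g} v 1 bounds
  where
  bounds : ∀ j → T (g j) → v ≤ j × j < v + 1
  bounds j gj with g⊆ j gj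
  ... | refl = ≤-refl , m<m+n j z<s

count-≥-point : ∀ g {h a} → T (g h) → h < a → suc (count g h) ≤ count g a
count-≥-point g {h} {a} gh h<a = subst (_≤ count g a) (count-step {g} gh) (count-monoʳ g h<a)

count-≥-interval : ∀ g a w → (∀ j → a ≤ j → j < a + w → T (g j)) → w + count g a ≤ count g (a + w)
count-≥-interval g a zero _ = ≤-reflexive (cong (count g) (sym (+-identityʳ a)))
count-≥-interval g a (suc w) g⊇ = begin
  suc (w + count g a)    ≤⟨ s≤s (count-≥-interval g a w λ j a≤j j<a+w →
                              g⊇ j a≤j (<-≤-trans j<a+w (+-monoʳ-≤ a (n≤1+n w)))) ⟩
  suc (count g (a + w))  ≡⟨ count-step {g} (g⊇ (a + w) (m≤m+n a w) (+-monoʳ-< a (n<1+n w))) ⟨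
  count g (suc (a + w))  ≡⟨ cong (count g) (+-suc a w) ⟨
  count g (a + suc w)    ∎
  where open ≤-Reasoning

count-shift : ∀ g n → count g (suc n) ≡ (if g 0 then 1 else 0) + count (g ∘ suc) n
count-shift g zero = sym (+-identityʳ _)
count-shift g (suc n) with g (suc n)
... | true  = trans (cong suc (count-shift g n)) (sym (+-suc _ _))
... | false = count-shift g n

length-filter-tabulate : ∀ {A : Set} {n} (P : A → Bool) (f : Fin n → A) (g : ℕ → Bool) →
  (∀ i → P (f i) ≡ g (toℕ i)) → length (filter (T? ∘ P) (tabulate f)) ≡ count g n
length-filter-tabulate {n = zero} P f g P∘f≗g = refl
length-filter-tabulate {n = suc n} P f g P∘f≗g = trans split (sym (count-shift g n))
  where
  split : length (filter (T? ∘ P) (tabulate f)) ≡ (if g 0 then 1 else 0) + count (g ∘ suc) n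
  split with P (f zero) | g 0 | P∘f≗g zero
           | length-filter-tabulate P (f ∘ suc) (g ∘ suc) (P∘f≗g ∘ suc)
  ... | true  | true  | refl | ih = cong suc ih
  ... | false | false | refl | ih = ih
  ... | true  | false | ()   | _
  ... | false | true  | ()   | _

length-filter-allFin : ∀ n (g : ℕ → Bool) → length (filter (T? ∘ g ∘ toℕ) (allFin n)) ≡ count g n
length-filter-allFin n g = length-filter-tabulate {n = n} (g ∘ toℕ) id g (λ _ → refl)

interval : ℕ → ℕ → ℕ → Bool
interval a w j = (a ≤ᵇ j) ∧ (j <ᵇ a + w)

interval-intro : ∀ {a w j} → a ≤ j → j < a + w → T (interval a w j)
interval-intro a≤j j<a+w = Equivalence.from T-∧ (≤⇒≤ᵇ a≤j , <⇒<ᵇ j<a+w)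

interval-elim : ∀ {a w j} → T (interval a w j) → a ≤ j × j < a + w
interval-elim {a} {w} {j} = Product.map (≤ᵇ⇒≤ a j) (<ᵇ⇒< j (a + w)) ∘ Equivalence.to T-∧

count-interval : ∀ a w n → count (interval a w) n ≤ w
count-interval a w = count-⊆-interval a w (λ _ → interval-elim)

-- Complete digraphs with a set of arcs removed

module _ {n : ℕ} (miss : ℕ → ℕ → Bool) (miss-refl : ∀ k → T (miss k k)) where

  complementOf : Digraph n
  complementOf = record
    { adj      = λ v w → not (miss (toℕ v) (toℕ w))
    ; loopless = λ v → cong not (Equivalence.to T-≡ (miss-refl (toℕ v)))
    }

  complementOf-edge : ∀ {u w} → Edge complementOf u w → ¬ T (miss (toℕ u) (toℕ w))
  complementOf-edge {u} {w} uw with miss (toℕ u) (toℕ w)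
  ... | true = λ _ → uw
  ... | false = λ ()

  outdeg-complementOf : ∀ v → outdeg complementOf v ≡ n ∸ count (miss (toℕ v)) n
  outdeg-complementOf v = trans
    (length-filter-allFin n (not ∘ miss (toℕ v))) (count-not (miss (toℕ v)) n)

  indeg-complementOf : ∀ v → indeg complementOf v ≡ n ∸ count (λ k → miss k (toℕ v)) n
  indeg-complementOf v = trans
    (length-filter-allFin n (λ k → not (miss k (toℕ v)))) (count-not (λ k → miss k (toℕ v)) n)

  complementOf-minDegree : ∀ c →
    (∀ k → count (miss k) n ≤ c) → (∀ j → count (λ k → miss k j) n ≤ c) →
    (v : Fin n) → count (miss (toℕ v)) n ≡ c → MinDegreeIs complementOf (n ∸ c)
  complementOf-minDegree c out≤ in≤ v out≡ =
    (λ w → subst (n ∸ c ≤_) (sym (outdeg-complementOf w)) (∸-monoʳ-≤ n (out≤ (toℕ w)))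
         , subst (n ∸ c ≤_) (sym (indeg-complementOf w)) (∸-monoʳ-≤ n (in≤ (toℕ w))))
    , v , inj₁ (trans (outdeg-complementOf v) (cong (n ∸_) out≡))

-- Paths and linkages

StartsAt⇒∈ : ∀ {n} {P : List (Fin n)} {x} → StartsAt P x → x ∈ P
StartsAt⇒∈ {P = []}    ()
StartsAt⇒∈ {P = _ ∷ _} refl = here refl

EndsAt⇒∈ : ∀ {n} {P : List (Fin n)} {y} → EndsAt P y → y ∈ P
EndsAt⇒∈ {P = []}        ()
EndsAt⇒∈ {P = _ ∷ []}    refl = here refl
EndsAt⇒∈ {P = _ ∷ _ ∷ _} e    = there (EndsAt⇒∈ e)

exit-edge : ∀ {n} (D : Digraph n) (S : Fin n → Bool) (P : List (Fin n)) {x y} →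
  StartsAt P x → EndsAt P y → Walk D P → T (S x) → ¬ T (S y) →
  ∃[ u ] ∃[ w ] (w ∈ P × T (S u) × ¬ T (S w) × Edge D u w)
exit-edge D S []          ()
exit-edge D S (u ∷ [])     refl refl _ Su ¬Su = ⊥-elim (¬Su Su)
exit-edge D S (u ∷ v ∷ P) refl ends (uv , walk) Su ¬Sy
  with T? (S v) | exit-edge D S (v ∷ P) refl ends walk
... | no ¬Sv | _    = u , v , there (here refl) , Su , ¬Sv , uv
... | yes Sv | exit with exit Sv ¬Sy
...   | a , b , b∈ , out = a , b , there b∈ , out

Terminal : ∀ {n ℓ} → (x y : Fin ℓ → Fin n) → Fin ℓ → Fin n → Set
Terminal x y j w = w ≡ x j ⊎ w ≡ y j

module LinkageProperties {n ℓ} {D : Digraph n} {x y : Fin ℓ → Fin n}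
  (P : Fin ℓ → List (Fin n))
  (isPath : ∀ i → IsPath D (x i) (y i) (P i))
  (disjoint : ∀ i j → i ≢ j → Disjoint (P i) (P j)) where

  terminal∈ : ∀ j {w} → Terminal x y j w → w ∈ P j
  terminal∈ j (inj₁ refl) = StartsAt⇒∈ (proj₁ (isPath j))
  terminal∈ j (inj₂ refl) = EndsAt⇒∈ (proj₁ (proj₂ (isPath j)))

  passes-through : ∀ i (S : Fin n → Bool) (H : Fin n → Set) → T (S (x i)) → ¬ T (S (y i)) →
    (∀ {u w} → T (S u) → ¬ T (S w) → Edge D u w → H w ⊎ ∃[ j ] (j ≢ i × Terminal x y j w)) →
    ∃[ w ] (w ∈ P i × H w)
  passes-through i S H Sx ¬Sy exits
    with (starts , ends , walk , _) ← isPath i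
    with exit-edge D S (P i) starts ends walk Sx ¬Sy
  ... | u , w , w∈P , Su , ¬Sw , uw with exits Su ¬Sw uw
  ...   | inj₁ Hw               = w , w∈P , Hw
  ...   | inj₂ (j , j≢i , term) = ⊥-elim (disjoint i j (j≢i ∘ sym) w w∈P (terminal∈ j term))

-- Vertex layout: xᵢ = i and yᵢ = ℓ + i for i < ℓ, then R₁ = [2ℓ, 2ℓ + q),
-- R₂ = [2ℓ + q, 2ℓ + 2q) and the hub 2ℓ + 2q, which is a vertex only when r is odd.
module Construction (m r q : ℕ) (q≤r : q ≤ r) (r≤1+2q : r ≤ suc (q + q)) where

  ℓ n c hub : ℕ
  ℓ   = suc (suc m)
  n   = ℓ + ℓ + r
  c   = ℓ + ℓ
  hub = c + (q + q)

  x y : Fin ℓ → Fin n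
  x i = (i ↑ˡ ℓ) ↑ˡ r
  y i = (ℓ ↑ʳ i) ↑ˡ r

  data Position : Fin n → Set where
    source : ∀ i → Position (x i)
    target : ∀ i → Position (y i)
    core   : ∀ k → Position (c ↑ʳ k)

  position : ∀ v → Position v
  position v with splitAt c v in v≡
  ... | inj₂ k = subst Position (splitAt⁻¹-↑ʳ v≡) (core k)
  ... | inj₁ u with splitAt ℓ u in u≡
  ...   | inj₁ i = subst Position (trans (cong (_↑ˡ r) (splitAt⁻¹-↑ˡ u≡)) (splitAt⁻¹-↑ˡ v≡)) (source i)
  ...   | inj₂ i = subst Position (trans (cong (_↑ˡ r) (splitAt⁻¹-↑ʳ u≡)) (splitAt⁻¹-↑ˡ v≡)) (target i)

  toℕ-y : ∀ i → toℕ (y i) ≡ ℓ + toℕ i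
  toℕ-y i = trans (toℕ-↑ˡ (ℓ ↑ʳ i) r) (toℕ-↑ʳ ℓ i)

  distinct : AllDistinct x y
  distinct = (λ e → ↑ˡ-injective ℓ _ _ (↑ˡ-injective r _ _ e))
           , (λ e → ↑ʳ-injective ℓ _ _ (↑ˡ-injective r _ _ e))
           , λ i j e → <⇒≢ (x<y i j) (cong toℕ e)
    where
    x<y : ∀ i j → toℕ (x i) < toℕ (y j)
    x<y i j rewrite toℕ-↑ˡ (i ↑ˡ ℓ) r | toℕ-↑ˡ i ℓ | toℕ-y j = <-≤-trans (toℕ<n i) (m≤m+n ℓ (toℕ j))

  ℓ<c : ℓ < c
  ℓ<c = m<m+n ℓ z<s

  1+ℓ<c : suc ℓ < c
  1+ℓ<c = subst (_≤ c) (+-comm ℓ 2) (+-monoʳ-≤ ℓ (s≤s (s≤s z≤n)))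

  1+ℓ<c+q : suc ℓ < c + q
  1+ℓ<c+q = <-≤-trans 1+ℓ<c (m≤m+n c q)

  c+q≤n : c + q ≤ n
  c+q≤n = +-monoʳ-≤ c q≤r

  block : ℕ → ℕ → ℕ → Bool
  block v a j = (j ≡ᵇ v) ∨ interval a q j

  block-∋ : ∀ {v a j} → j ≡ v → T (block v a j)
  block-∋ {v} refl = Equivalence.from T-∨ (inj₁ (≡⇒≡ᵇ v v refl))

  block-⊇ : ∀ {v a j} → T (interval a q j) → T (block v a j)
  block-⊇ = Equivalence.from T-∨ ∘ inj₂

  block-elim : ∀ {v a j} → T (block v a j) → j ≡ v ⊎ (a ≤ j × j < a + q)
  block-elim {v} {a} {j} = Sum.map (≡ᵇ⇒≡ j v) interval-elim ∘ Equivalence.to T-∨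

  block-∌ : ∀ {v a j} → j ≢ v → j < a → ¬ T (block v a j)
  block-∌ j≢v j<a b = [ j≢v , (λ (a≤j , _) → <⇒≱ j<a a≤j) ]′ (block-elim b)

  block-disjoint : ∀ {v v′ a a′ j} → v ≢ v′ → v < a′ → v′ < a → a + q ≤ a′ →
    T (block v a j) → ¬ T (block v′ a′ j)
  block-disjoint {v} {v′} {a} {a′} {j} v≢v′ v<a′ v′<a a+q≤a′ b b′
    with block-elim {v} {a} {j} b | block-elim {v′} {a′} {j} b′
  ... | inj₁ refl           | inj₁ refl        = v≢v′ refl
  ... | inj₁ refl           | inj₂ (a′≤j , _)  = <⇒≱ v<a′ a′≤j
  ... | inj₂ (a≤j , _)      | inj₁ refl        = <⇒≱ v′<a a≤j
  ... | inj₂ (_ , j<a+q)    | inj₂ (a′≤j , _)  = <⇒≱ j<a+q (≤-trans a+q≤a′ a′≤j)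

  count-block : ∀ v a n′ → count (block v a) n′ ≤ suc q
  count-block v a n′ = ≤-trans (count-∨ (_≡ᵇ v) (interval a q) n′)
    (+-mono-≤ (count-singleton v (λ j → ≡ᵇ⇒≡ j v) n′) (count-interval a q n′))

  count-⊆-block : ∀ {g} v a → (∀ j → T (g j) → T (block v a j)) → count g n ≤ suc q
  count-⊆-block v a g⊆ = ≤-trans (count-⊆ g⊆ n) (count-block v a n)

  A₁ B₁ A₂ B₂ : ℕ → Bool
  A₁ = block 0 c
  B₁ = block ℓ (c + q)
  A₂ = block 1 (c + q)
  B₂ = block (suc ℓ) c

  A₁∩A₂ : ∀ {k} → T (A₁ k) → ¬ T (A₂ k)
  A₁∩A₂ {k} = block-disjoint {0} {1} {c} {c + q} {k} (λ ()) z<s (s≤s (s≤s z≤n)) ≤-refl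

  B₁∩B₂ : ∀ {j} → T (B₁ j) → ¬ T (B₂ j)
  B₁∩B₂ {j} b₁ b₂ =
    block-disjoint {suc ℓ} {ℓ} {c} {c + q} {j} (<⇒≢ (n<1+n ℓ) ∘ sym) 1+ℓ<c+q ℓ<c ≤-refl b₂ b₁

  core-split : ∀ {j} → c ≤ j → j < hub → T (interval c q j) ⊎ T (interval (c + q) q j)
  core-split {j} c≤j j<hub with j <? c + q
  ... | yes j<c+q = inj₁ (interval-intro c≤j j<c+q)
  ... | no  j≮c+q = inj₂ (interval-intro (≮⇒≥ j≮c+q) (subst (j <_) (sym (+-assoc c q q)) j<hub))

  blocked miss : ℕ → ℕ → Bool
  blocked k j = (A₁ k ∧ B₁ j) ∨ (A₂ k ∧ B₂ j)
  miss k j = (k ≡ᵇ j) ∨ blocked k j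

  miss-refl : ∀ k → T (miss k k)
  miss-refl k = Equivalence.from T-∨ (inj₁ (≡⇒≡ᵇ k k refl))

  D : Digraph n
  D = complementOf miss miss-refl

  blocked-elim : ∀ {k j} → T (blocked k j) → (T (A₁ k) × T (B₁ j)) ⊎ (T (A₂ k) × T (B₂ j))
  blocked-elim {k} {j} =
    Sum.map (Equivalence.to T-∧) (Equivalence.to T-∧) ∘ Equivalence.to (T-∨ {A₁ k ∧ B₁ j} {A₂ k ∧ B₂ j})

  miss₁ : ∀ {k j} → T (A₁ k) → T (B₁ j) → T (miss k j)
  miss₁ {k} {j} a b =
    Equivalence.from (T-∨ {k ≡ᵇ j}) (inj₂ (Equivalence.from T-∨ (inj₁ (Equivalence.from T-∧ (a , b)))))

  miss₂ : ∀ {k j} → T (A₂ k) → T (B₂ j) → T (miss k j)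
  miss₂ {k} {j} a b = Equivalence.from (T-∨ {k ≡ᵇ j})
    (inj₂ (Equivalence.from (T-∨ {A₁ k ∧ B₁ j}) (inj₂ (Equivalence.from T-∧ (a , b)))))

  count-blocked-out : ∀ k → count (blocked k) n ≤ suc q
  count-blocked-out k with T? (A₁ k)
  ... | yes a₁ = count-⊆-block {blocked k} ℓ (c + q) λ j →
    [ proj₂ , (λ (a₂ , _) → ⊥-elim (A₁∩A₂ {k} a₁ a₂)) ]′ ∘ blocked-elim {k} {j}
  ... | no ¬a₁ = count-⊆-block {blocked k} (suc ℓ) c λ j →
    [ (λ (a₁ , _) → ⊥-elim (¬a₁ a₁)) , proj₂ ]′ ∘ blocked-elim {k} {j}

  count-blocked-in : ∀ j → count (λ k → blocked k j) n ≤ suc q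
  count-blocked-in j with T? (B₁ j)
  ... | yes b₁ = count-⊆-block {λ k → blocked k j} 0 c λ k →
    [ proj₁ , (λ (_ , b₂) → ⊥-elim (B₁∩B₂ {j} b₁ b₂)) ]′ ∘ blocked-elim {k} {j}
  ... | no ¬b₁ = count-⊆-block {λ k → blocked k j} 1 (c + q) λ k →
    [ (λ (_ , b₁) → ⊥-elim (¬b₁ b₁)) , proj₁ ]′ ∘ blocked-elim {k} {j}

  count-miss-out : ∀ k → count (miss k) n ≤ suc (suc q)
  count-miss-out k = ≤-trans (count-∨ (k ≡ᵇ_) (blocked k) n)
    (+-mono-≤ (count-singleton k (λ j → sym ∘ ≡ᵇ⇒≡ k j) n) (count-blocked-out k))

  count-miss-in : ∀ j → count (λ k → miss k j) n ≤ suc (suc q)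
  count-miss-in j = ≤-trans (count-∨ (_≡ᵇ j) (λ k → blocked k j) n)
    (+-mono-≤ (count-singleton j (λ k → ≡ᵇ⇒≡ k j) n) (count-blocked-in j))

  count-miss-x₂ : suc (suc q) ≤ count (miss 1) n
  count-miss-x₂ = begin
    suc (suc q)                ≡⟨ +-comm 2 q ⟩
    q + 2                      ≤⟨ +-monoʳ-≤ q (s≤s (s≤s z≤n)) ⟩
    q + suc (suc (count g 1))  ≤⟨ +-monoʳ-≤ q (s≤s (count-≥-point g {1} {suc ℓ} _ (s≤s (s≤s z≤n)))) ⟩
    q + suc (count g (suc ℓ))  ≤⟨ +-monoʳ-≤ q (count-≥-point g {suc ℓ} {c} 1+ℓ∈g 1+ℓ<c) ⟩
    q + count g c              ≤⟨ count-≥-interval g c q R₁⊆g ⟩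
    count g (c + q)            ≤⟨ count-monoʳ g c+q≤n ⟩
    count g n                  ∎
    where
    open ≤-Reasoning
    g : ℕ → Bool
    g = miss 1
    1∈A₂ : T (A₂ 1)
    1∈A₂ = block-∋ {1} {c + q} refl
    1+ℓ∈g : T (g (suc ℓ))
    1+ℓ∈g = miss₂ {1} {suc ℓ} 1∈A₂ (block-∋ {suc ℓ} {c} refl)
    R₁⊆g : ∀ j → c ≤ j → j < c + q → T (g j)
    R₁⊆g j c≤j j<c+q = miss₂ {1} {j} 1∈A₂ (block-⊇ {suc ℓ} {c} {j} (interval-intro c≤j j<c+q))

  minDegree : MinDegreeIs D (n ∸ suc (suc q))
  minDegree = complementOf-minDegree miss miss-refl (suc (suc q)) count-miss-out count-miss-in
    (x (suc zero)) (≤-antisym (count-miss-out 1) count-miss-x₂)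

  outside-blocks : ∀ i (A B : ℕ → Bool) → T (A (toℕ (x i))) → T (B (toℕ (y i))) →
    (∀ {j} → c ≤ j → j < hub → T (A j) ⊎ T (B j)) →
    ∀ w → ¬ T (A (toℕ w)) → ¬ T (B (toℕ w)) → toℕ w ≡ hub ⊎ ∃[ j ] (j ≢ i × Terminal x y j w)
  outside-blocks i A B Axᵢ Byᵢ covers w ¬A ¬B with position w
  ... | source j with j ≟ᶠ i
  ...   | yes refl = ⊥-elim (¬A Axᵢ)
  ...   | no  j≢i  = inj₂ (j , j≢i , inj₁ refl)
  outside-blocks i A B Axᵢ Byᵢ covers w ¬A ¬B | target j with j ≟ᶠ i
  ...   | yes refl = ⊥-elim (¬B Byᵢ)
  ...   | no  j≢i  = inj₂ (j , j≢i , inj₂ refl)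
  outside-blocks i A B Axᵢ Byᵢ covers w ¬A ¬B | core k with toℕ k <? q + q
  ...   | yes k<2q = ⊥-elim ([ ¬A ∘ subst (T ∘ A) (sym w≡) , ¬B ∘ subst (T ∘ B) (sym w≡) ]′
                               (covers (m≤m+n c (toℕ k)) (+-monoʳ-< c k<2q)))
    where
    w≡ : toℕ (c ↑ʳ k) ≡ c + toℕ k
    w≡ = toℕ-↑ʳ c k
  ...   | no  k≮2q = inj₁ (trans (toℕ-↑ʳ c k)
                               (cong (c +_) (≤-antisym (s≤s⁻¹ (<-≤-trans (toℕ<n k) r≤1+2q)) (≮⇒≥ k≮2q))))

  covers₁ : ∀ {j} → c ≤ j → j < hub → T (A₁ j) ⊎ T (B₁ j)
  covers₁ {j} c≤j j<hub = Sum.map (block-⊇ {0} {c} {j}) (block-⊇ {ℓ} {c + q} {j}) (core-split c≤j j<hub)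

  covers₂ : ∀ {j} → c ≤ j → j < hub → T (A₂ j) ⊎ T (B₂ j)
  covers₂ {j} c≤j j<hub =
    Sum.swap (Sum.map (block-⊇ {suc ℓ} {c} {j}) (block-⊇ {1} {c + q} {j}) (core-split c≤j j<hub))

  y₁∈B₁ : T (B₁ (toℕ (y zero)))
  y₁∈B₁ = subst (T ∘ B₁) (sym (toℕ-y zero)) (block-∋ {ℓ} {c + q} (+-identityʳ ℓ))

  y₁∉A₁ : ¬ T (A₁ (toℕ (y zero)))
  y₁∉A₁ = block-∌ {0} {c} (λ ()) (subst (_< c) (sym (+-identityʳ ℓ)) ℓ<c) ∘ subst (T ∘ A₁) (toℕ-y zero)

  y₂∈B₂ : T (B₂ (toℕ (y (suc zero))))
  y₂∈B₂ = subst (T ∘ B₂) (sym (toℕ-y (suc zero))) (block-∋ {suc ℓ} {c} (+-comm ℓ 1))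

  y₂∉A₂ : ¬ T (A₂ (toℕ (y (suc zero))))
  y₂∉A₂ = block-∌ {1} {c + q} (λ ()) (subst (_< c + q) (+-comm 1 ℓ) 1+ℓ<c+q)
        ∘ subst (T ∘ A₂) (toℕ-y (suc zero))

  exit₁ : ∀ {u w} → T (A₁ (toℕ u)) → ¬ T (A₁ (toℕ w)) → Edge D u w →
    toℕ w ≡ hub ⊎ ∃[ j ] (j ≢ zero × Terminal x y j w)
  exit₁ {u} {w} a ¬a uw = outside-blocks zero A₁ B₁ _ y₁∈B₁ covers₁ w ¬a
    (complementOf-edge miss miss-refl {u} {w} uw ∘ miss₁ {toℕ u} {toℕ w} a)

  exit₂ : ∀ {u w} → T (A₂ (toℕ u)) → ¬ T (A₂ (toℕ w)) → Edge D u w →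
    toℕ w ≡ hub ⊎ ∃[ j ] (j ≢ suc zero × Terminal x y j w)
  exit₂ {u} {w} a ¬a uw = outside-blocks (suc zero) A₂ B₂ _ y₂∈B₂ covers₂ w ¬a
    (complementOf-edge miss miss-refl {u} {w} uw ∘ miss₂ {toℕ u} {toℕ w} a)

  no-linkage : ∀ {P} → (∀ i → IsPath D (x i) (y i) (P i)) → (∀ i j → i ≢ j → Disjoint (P i) (P j)) → ⊥
  no-linkage {P} isPath disjoint with hub∈P₁ | hub∈P₂
    where
    open LinkageProperties P isPath disjoint
    hub∈P₁ : ∃[ w ] (w ∈ P zero × toℕ w ≡ hub)
    hub∈P₁ = passes-through zero (A₁ ∘ toℕ) ((_≡ hub) ∘ toℕ) _ y₁∉A₁ (λ {u} {w} → exit₁ {u} {w})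
    hub∈P₂ : ∃[ w ] (w ∈ P (suc zero) × toℕ w ≡ hub)
    hub∈P₂ = passes-through (suc zero) (A₂ ∘ toℕ) ((_≡ hub) ∘ toℕ) _ y₂∉A₂ (λ {u} {w} → exit₂ {u} {w})
  ... | w₁ , w₁∈P₁ , w₁≡hub | w₂ , w₂∈P₂ , w₂≡hub =
    disjoint zero (suc zero) (λ ()) w₁ w₁∈P₁
      (subst (_∈ P (suc zero)) (toℕ-injective (trans w₂≡hub (sym w₁≡hub))) w₂∈P₂)

  notLinked : ¬ Linked ℓ D
  notLinked (_ , link) with link x y distinct
  ... | _ , isPath , disjoint = no-linkage isPath disjoint

⌈n+n+m/2⌉≡n+⌈m/2⌉ : ∀ n m → ⌈ n + n + m /2⌉ ≡ n + ⌈ m /2⌉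
⌈n+n+m/2⌉≡n+⌈m/2⌉ zero    m = refl
⌈n+n+m/2⌉≡n+⌈m/2⌉ (suc n) m =
  trans (cong (λ k → ⌈ suc k + m /2⌉) (+-suc n n)) (cong suc (⌈n+n+m/2⌉≡n+⌈m/2⌉ n m))

n≤1+⌊n/2⌋+⌊n/2⌋ : ∀ n → n ≤ suc (⌊ n /2⌋ + ⌊ n /2⌋)
n≤1+⌊n/2⌋+⌊n/2⌋ zero          = z≤n
n≤1+⌊n/2⌋+⌊n/2⌋ (suc zero)    = s≤s z≤n
n≤1+⌊n/2⌋+⌊n/2⌋ (suc (suc n)) =
  s≤s (s≤s (≤-trans (n≤1+⌊n/2⌋+⌊n/2⌋ n) (≤-reflexive (sym (+-suc _ _)))))

⌈n/2⌉+ℓ∸2≡n∸[2+⌊r/2⌋] : ∀ m r → let ℓ = suc (suc m) in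
  ⌈ ℓ + ℓ + r /2⌉ + ℓ ∸ 2 ≡ ℓ + ℓ + r ∸ suc (suc ⌊ r /2⌋)
⌈n/2⌉+ℓ∸2≡n∸[2+⌊r/2⌋] m r = begin
  ⌈ ℓ + ℓ + r /2⌉ + ℓ ∸ 2                ≡⟨ cong (λ k → k + ℓ ∸ 2) (⌈n+n+m/2⌉≡n+⌈m/2⌉ ℓ r) ⟩
  m + ⌈ r /2⌉ + ℓ                        ≡⟨ m+n∸m≡n ⌊ r /2⌋ _ ⟨
  ⌊ r /2⌋ + (m + ⌈ r /2⌉ + ℓ) ∸ ⌊ r /2⌋  ≡⟨ cong (_∸ ⌊ r /2⌋) rearrange ⟩
  m + ℓ + r ∸ ⌊ r /2⌋                    ∎
  where
  open ≡-Reasoning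
  open +-*-Solver
  ℓ : ℕ
  ℓ = suc (suc m)
  rearrange : ⌊ r /2⌋ + (m + ⌈ r /2⌉ + ℓ) ≡ m + ℓ + r
  rearrange = trans
    (solve 4 (λ f m′ e l → f :+ (m′ :+ e :+ l) := m′ :+ l :+ (f :+ e)) refl ⌊ r /2⌋ m ⌈ r /2⌉ ℓ)
    (cong (m + ℓ +_) (⌊n/2⌋+⌈n/2⌉≡n r))

proposition3 : (ℓ n : ℕ) → 2 ≤ ℓ → ℓ + ℓ ≤ n →
    Σ (Digraph n) λ D → MinDegreeIs D (⌈ n /2⌉ + ℓ ∸ 2) × ¬ Linked ℓ D
proposition3 (suc (suc m)) _ (s≤s (s≤s z≤n)) 2ℓ≤n with m≤n⇒∃[o]m+o≡n 2ℓ≤n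
... | r , refl =
  D , subst (MinDegreeIs D) (sym (⌈n/2⌉+ℓ∸2≡n∸[2+⌊r/2⌋] m r)) minDegree , notLinked
  where open Construction m r ⌊ r /2⌋ (⌊n/2⌋≤n r) (n≤1+⌊n/2⌋+⌊n/2⌋ r) using (D; minDegree; notLinked)
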